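{- Let $n,m$ be positive integers and let $k\ge 2$ be an integer such that $n>2^{m H_2(1/k)}$, where $H_2(x)=-x\log_2 x-(1-x)\log_2(1-x)$. Then $g(n,m)\le kn$.
   Context: Write $[m]=\{1,\ldots,m\}$. For a multiset $\mathcal{F}=\{C_1,\ldots,C_t\}$ of non-empty subsets of $[m]$ (repetitions allowed; members indexed by $[t]$), a resolution into $n$ classes is a partition $\{A_1,\ldots,A_n\}$ of $[t]$ into $n$ blocks such that for each $i$ the sets $C_j$, $j\in A_i$, are pairwise disjoint with union $[m]$. $\mathcal{F}$ is uniquely resolvable with respect to $(n,m)$ if it has exactly one resolution into $n$ classes (partitions regarded as unordered). $g(n,m)$ is the maximum size of a uniquely resolvable multiset with respect to $(n,m)$. -}

module Defs where

open import Data.Nat using (ℕ; _*_; _^_; _∸_)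
open import Data.Fin using (Fin)
open import Data.Fin.Subset using (Subset; _∈_; _∩_; Nonempty; Empty)
open import Data.Product using (Σ; ∃; _×_)
open import Relation.Binary.PropositionalEquality using (_≡_; _≢_)
open import Function.Bundles using (_⇔_)

-- A multiset F = {C_1,...,C_t} of subsets of [m], indexed by Fin t.
Multiset : ℕ → ℕ → Set
Multiset m t = Fin t → Subset m

AllNonempty : ∀ {m t} → Multiset m t → Set
AllNonempty F = ∀ j → Nonempty (F j)

-- A partition of [t] into n blocks, given by a labelling c : [t] → [n]
-- with every label used (every block non-empty).  The block A_i is c⁻¹(i).
IsPartition : ∀ {t} n → (Fin t → Fin n) → Set
IsPartition n c = ∀ (i : Fin n) → ∃ λ j → c j ≡ i

IsResolution : ∀ {m t} n → Multiset m t → (Fin t → Fin n) → Set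
IsResolution {m} {t} n F c =
  IsPartition n c
  × (∀ (i : Fin n) →
       (∀ (j j' : Fin t) → j ≢ j' → c j ≡ i → c j' ≡ i → Empty (F j ∩ F j'))
       × (∀ (x : Fin m) → ∃ λ j → c j ≡ i × x ∈ F j))

SamePartition : ∀ {t n} → (Fin t → Fin n) → (Fin t → Fin n) → Set
SamePartition {t} c c' = ∀ (j j' : Fin t) → (c j ≡ c j') ⇔ (c' j ≡ c' j')

UniquelyResolvable : ∀ {m t} n → Multiset m t → Set
UniquelyResolvable n F =
  Σ _ λ c → IsResolution n F c × (∀ c' → IsResolution n F c' → SamePartition c c')

-- The real-number hypothesis n > 2^{m H₂(1/k)} is equivalent (for k ≥ 2) to
-- n^k · (k-1)^{m(k-1)} > k^{mk}, since 2^{m H₂(1/k)} = (k^k/(k-1)^{k-1})^{m/k}.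
EntropyBound : ℕ → ℕ → ℕ → Set
EntropyBound n m k = k ^ (m * k) Data.Nat.< n ^ k * (k ∸ 1) ^ (m * (k ∸ 1))

{-# OPTIONS --safe #-}
module Submission where

-- Call a member C of F small when k ∣C∣ ≤ m and large otherwise.  Each class of a resolution
-- partitions [m], so it contains at most k - 1 large members; hence t > k n forces more than n
-- small members.  Small members are proper subsets of [m], and a proper member C is never
-- repeated: swapping two copies of C yields another resolution, which by uniqueness induces the
-- same partition; but the class of one copy also contains a member covering a point outside C,
-- and that member would then share a class with the other copy, putting two equal nonempty sets
-- in one class.  Weighting a set S by (k - 1) ^ ∣∁ S∣, the subsets of [m] weigh k ^ m in total
-- and each small member weighs at least r = (k - 1) ^ (m ∸ ⌊m / k⌋), so n r ≤ k ^ m; raising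
-- this to the k-th power contradicts n ^ k (k - 1) ^ (m (k - 1)) > k ^ (m k).

open import Data.Bool using (if_then_else_) renaming (_≟_ to _≟ᵇ_)
open import Data.Empty using (⊥-elim)
open import Data.Fin using (Fin; zero; suc; punchIn)
open import Data.Fin.Permutation as Perm using (Permutation; _⟨$⟩ʳ_; _⟨$⟩ˡ_)
open import Data.Fin.Properties as Fin using (punchInᵢ≢i) renaming (_≟_ to _≟ᶠ_)
open import Data.Fin.Subset using (Subset; inside; outside; _∈_; _∩_; ∣_∣; ∁; ⊤; Empty)
open import Data.Fin.Subset.Properties using (_∈?_; x∈p∩q⁺; ∣⊤∣≡n; p⊆q⇒∣p∣≤∣q∣; ∣∁p∣≡n∸∣p∣)
open import Data.Nat
  using (ℕ; zero; suc; _+_; _*_; _^_; _∸_; _≤_; _<_; _≥_; z≤n; s≤s; NonZero; >-nonZero; >-nonZero⁻¹)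
open import Data.Nat.DivMod using (_/_; m*n/n≡m; /-monoˡ-≤; m/n*n≤m; m/n<m)
open import Data.Nat.Properties
open import Algebra.Properties.Semiring.Sum +-*-semiring
  using (sum; sum-syntax; sum-cong-≗; sum-remove; ∑-comm; ∑-distrib-+; *-distribˡ-sum; *-distribʳ-sum)
open import Data.Product using (∃; _×_; _,_; proj₁; proj₂)
open import Data.Vec using ([]; _∷_)
open import Data.Vec.Properties using (≡-dec)
open import Function using (_∘_)
open import Function.Bundles using (_⇔_; Equivalence)
open import Relation.Binary using (DecidableEquality)
open import Relation.Binary.PropositionalEquality
open import Relation.Nullary using (Dec; yes; no; ¬_; does; contradiction)
open import Relation.Nullary.Decidable using (_×-dec_; ¬?; dec-true; dec-false)
open import Relation.Unary using (Pred; Decidable)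

open import Defs

-- χ inspects only `does`, so it computes through Dec.map′; ∣p∣≡∑χ∈ depends on this.
χ : ∀ {p} {A : Set p} → Dec A → ℕ
χ a? = if does a? then 1 else 0

χ-yes : ∀ {p} {A : Set p} (a? : Dec A) → A → χ a? ≡ 1
χ-yes (yes _) _ = refl
χ-yes (no ¬a) a = ⊥-elim (¬a a)

χ-no : ∀ {p} {A : Set p} (a? : Dec A) → ¬ A → χ a? ≡ 0
χ-no (yes a) ¬a = ⊥-elim (¬a a)
χ-no (no _)  _  = refl

χ-× : ∀ {p q} {A : Set p} {B : Set q} (a? : Dec A) (b? : Dec B) →
      χ a? * χ b? ≡ χ (a? ×-dec b?)
χ-× (yes _) (yes _) = refl
χ-× (yes _) (no _)  = refl
χ-× (no _)  _       = refl

χ+χ¬ : ∀ {p} {A : Set p} (a? : Dec A) → χ a? + χ (¬? a?) ≡ 1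
χ+χ¬ (yes _) = refl
χ+χ¬ (no _)  = refl

χ*-monoʳ-≤ : ∀ {p} {A : Set p} (a? : Dec A) {x y} → (A → x ≤ y) → χ a? * x ≤ χ a? * y
χ*-monoʳ-≤ (yes a) x≤y = *-monoʳ-≤ 1 (x≤y a)
χ*-monoʳ-≤ (no _)  x≤y = z≤n

sum-const : ∀ t x → ∑[ j < t ] x ≡ t * x
sum-const zero    x = refl
sum-const (suc t) x = cong (x +_) (sum-const t x)

sum-zero : ∀ {t} {f : Fin t → ℕ} → (∀ j → f j ≡ 0) → sum f ≡ 0
sum-zero {t} f≡0 = trans (sum-cong-≗ f≡0) (trans (sum-const t 0) (*-zeroʳ t))

sum-mono-≤ : ∀ {t} {f g : Fin t → ℕ} → (∀ j → f j ≤ g j) → sum f ≤ sum g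
sum-mono-≤ {zero}  f≤g = z≤n
sum-mono-≤ {suc t} f≤g = +-mono-≤ (f≤g zero) (sum-mono-≤ (f≤g ∘ suc))

sum-χ+sum-χ¬ : ∀ {t p} {P : Pred (Fin t) p} (P? : Decidable P) →
               ∑[ j < t ] χ (P? j) + ∑[ j < t ] χ (¬? (P? j)) ≡ t
sum-χ+sum-χ¬ {t} P? = begin
  ∑[ j < t ] χ (P? j) + ∑[ j < t ] χ (¬? (P? j))  ≡⟨ ∑-distrib-+ (χ ∘ P?) (χ ∘ ¬? ∘ P?) ⟨
  ∑[ j < t ] (χ (P? j) + χ (¬? (P? j)))           ≡⟨ sum-cong-≗ (χ+χ¬ ∘ P?) ⟩
  ∑[ j < t ] 1                                    ≡⟨ sum-const t 1 ⟩
  t * 1                                           ≡⟨ *-identityʳ t ⟩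
  t                                               ∎
  where open ≡-Reasoning

atMostOne⇒sum-χ≤1 : ∀ {t p} {P : Pred (Fin t) p} (P? : Decidable P) →
                    (∀ i j → P i → P j → i ≡ j) → ∑[ j < t ] χ (P? j) ≤ 1
atMostOne⇒sum-χ≤1 {zero}  P? unique = z≤n
atMostOne⇒sum-χ≤1 {suc t} {P = P} P? unique with P? zero
... | no _   = atMostOne⇒sum-χ≤1 (P? ∘ suc) λ i j Pi Pj → Fin.suc-injective (unique (suc i) (suc j) Pi Pj)
... | yes P0 = s≤s (≤-reflexive (sum-zero λ j → χ-no (P? (suc j)) (rest-fails j)))
  where
  rest-fails : ∀ j → ¬ P (suc j)
  rest-fails j Pj = Fin.0≢1+n (unique zero (suc j) P0 Pj)

sum-δ : ∀ {n} (i : Fin n) (g : Fin n → ℕ) → ∑[ l < n ] (χ (i ≟ᶠ l) * g l) ≡ g i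
sum-δ {suc n} i g = begin
  ∑[ l < suc n ] (χ (i ≟ᶠ l) * g l)
    ≡⟨ sum-remove {i = i} (λ l → χ (i ≟ᶠ l) * g l) ⟩
  χ (i ≟ᶠ i) * g i + ∑[ l < n ] (χ (i ≟ᶠ punchIn i l) * g (punchIn i l))
    ≡⟨ cong₂ _+_ (cong (_* g i) (χ-yes (i ≟ᶠ i) refl)) (sum-zero off-diagonal) ⟩
  g i + 0 + 0
    ≡⟨ trans (+-identityʳ _) (+-identityʳ _) ⟩
  g i ∎
  where
  open ≡-Reasoning
  off-diagonal : ∀ l → χ (i ≟ᶠ punchIn i l) * g (punchIn i l) ≡ 0
  off-diagonal l = cong (_* g (punchIn i l)) (χ-no (i ≟ᶠ punchIn i l) (punchInᵢ≢i i l ∘ sym))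

sum-fibres : ∀ {t n} (c : Fin t → Fin n) (f : Fin t → ℕ) →
             sum f ≡ ∑[ i < n ] ∑[ j < t ] (χ (c j ≟ᶠ i) * f j)
sum-fibres {t} {n} c f = begin
  sum f                                         ≡⟨ sum-cong-≗ (λ j → sym (sum-δ (c j) (λ _ → f j))) ⟩
  ∑[ j < t ] ∑[ i < n ] (χ (c j ≟ᶠ i) * f j)    ≡⟨ ∑-comm (λ j i → χ (c j ≟ᶠ i) * f j) ⟩
  ∑[ i < n ] ∑[ j < t ] (χ (c j ≟ᶠ i) * f j)    ∎
  where open ≡-Reasoning

m*n≤o⇒n≤o/m : ∀ m {n o} .{{_ : NonZero m}} → m * n ≤ o → n ≤ o / m
m*n≤o⇒n≤o/m m {n} {o} m*n≤o =
  subst (_≤ o / m) (m*n/n≡m n m) (/-monoˡ-≤ m (subst (_≤ o) (*-comm m n) m*n≤o))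

^-distribʳ-* : ∀ x y e → (x * y) ^ e ≡ x ^ e * y ^ e
^-distribʳ-* x y zero    = refl
^-distribʳ-* x y (suc e) =
  trans (cong (x * y *_) (^-distribʳ-* x y e)) ([m*n]*[o*p]≡[m*o]*[n*p] x y (x ^ e) (y ^ e))

sum-χ*χ-large≤a : ∀ {t p} {P : Pred (Fin t) p} (P? : Decidable P) (s : Fin t → ℕ) {m} a →
                  ∑[ j < t ] (χ (P? j) * s j) ≤ m →
                  ∑[ j < t ] (χ (P? j) * χ (¬? (suc a * s j ≤? m))) ≤ a
sum-χ*χ-large≤a {t} {P = P} P? s {m} a ∑s≤m =
  ≤-pred (*-cancelˡ-< (suc m) (sum large) (suc a) (begin-strict
  suc m * sum large                   ≡⟨ *-distribˡ-sum (suc m) large ⟩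
  ∑[ j < t ] (suc m * large j)        ≤⟨ sum-mono-≤ pointwise ⟩
  ∑[ j < t ] (suc a * masked j)       ≡⟨ *-distribˡ-sum (suc a) masked ⟨
  suc a * sum masked                  ≤⟨ *-monoʳ-≤ (suc a) ∑s≤m ⟩
  suc a * m                           <⟨ *-monoʳ-< (suc a) ≤-refl ⟩
  suc a * suc m                       ≡⟨ *-comm (suc a) (suc m) ⟩
  suc m * suc a                       ∎))
  where
  open ≤-Reasoning
  large masked : Fin t → ℕ
  large j  = χ (P? j) * χ (¬? (suc a * s j ≤? m))
  masked j = χ (P? j) * s j
  pointwise : ∀ j → suc m * large j ≤ suc a * masked j
  pointwise j = by-cases (P? j) (suc a * s j ≤? m)
    where
    by-cases : (Pj? : Dec (P j)) (fits? : Dec (suc a * s j ≤ m)) →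
               suc m * (χ Pj? * χ (¬? fits?)) ≤ suc a * (χ Pj? * s j)
    by-cases (no _)  _          = ≤-trans (≤-reflexive (*-zeroʳ (suc m))) z≤n
    by-cases (yes _) (yes _)    = ≤-trans (≤-reflexive (*-zeroʳ (suc m))) z≤n
    by-cases (yes _) (no large) =
      subst₂ _≤_ (sym (*-identityʳ (suc m))) (cong (suc a *_) (sym (+-identityʳ (s j)))) (≰⇒> large)

pow-∸-≤ : ∀ a {m s} .{{_ : NonZero a}} → suc a * s ≤ m → a ^ (m ∸ m / suc a) ≤ a ^ (m ∸ s)
pow-∸-≤ a {m} as≤m = ^-monoʳ-≤ a (∸-monoʳ-≤ m (m*n≤o⇒n≤o/m (suc a) as≤m))

¬EntropyBound : ∀ n m a .{{_ : NonZero a}} →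
                n * a ^ (m ∸ m / suc a) ≤ suc a ^ m → ¬ EntropyBound n m (suc a)
¬EntropyBound n m a nr≤k^m = ≤⇒≯ (begin
  n ^ k * a ^ (m * a)                ≤⟨ *-monoʳ-≤ (n ^ k) (^-monoʳ-≤ a exponent-≤) ⟩
  n ^ k * a ^ ((m ∸ m / k) * k)      ≡⟨ cong (n ^ k *_) (^-*-assoc a (m ∸ m / k) k) ⟨
  n ^ k * (a ^ (m ∸ m / k)) ^ k      ≡⟨ ^-distribʳ-* n (a ^ (m ∸ m / k)) k ⟨
  (n * a ^ (m ∸ m / k)) ^ k          ≤⟨ ^-monoˡ-≤ k nr≤k^m ⟩
  (k ^ m) ^ k                        ≡⟨ ^-*-assoc k m k ⟩
  k ^ (m * k)                        ∎)
  where
  open ≤-Reasoning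
  k : ℕ
  k = suc a
  exponent-≤ : m * a ≤ (m ∸ m / k) * k
  exponent-≤ = begin
    m * a                  ≡⟨ m+n∸m≡n m (m * a) ⟨
    m + m * a ∸ m          ≡⟨ cong (_∸ m) (*-suc m a) ⟨
    m * k ∸ m              ≤⟨ ∸-monoʳ-≤ (m * k) (m/n*n≤m m k) ⟩
    m * k ∸ m / k * k      ≡⟨ *-distribʳ-∸ k m (m / k) ⟨
    (m ∸ m / k) * k        ∎

∣p∣≡∑χ∈ : ∀ {m} (p : Subset m) → ∣ p ∣ ≡ ∑[ x < m ] χ (x ∈? p)
∣p∣≡∑χ∈ []            = refl
∣p∣≡∑χ∈ (inside ∷ p)  = cong suc (∣p∣≡∑χ∈ p)
∣p∣≡∑χ∈ (outside ∷ p) = ∣p∣≡∑χ∈ p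

full⇒n≤∣p∣ : ∀ {m} {p : Subset m} → (∀ x → x ∈ p) → m ≤ ∣ p ∣
full⇒n≤∣p∣ {m} {p} full = subst (_≤ ∣ p ∣) (∣⊤∣≡n m) (p⊆q⇒∣p∣≤∣q∣ {p = ⊤} λ {x} _ → full x)

disjoint⇒sum-χ*∣∣≤n : ∀ {m t p} {P : Pred (Fin t) p} (P? : Decidable P) (F : Fin t → Subset m) →
                      (∀ j j' → j ≢ j' → P j → P j' → Empty (F j ∩ F j')) →
                      ∑[ j < t ] (χ (P? j) * ∣ F j ∣) ≤ m
disjoint⇒sum-χ*∣∣≤n {m} {t} {P = P} P? F disjoint = begin
  ∑[ j < t ] (χ (P? j) * ∣ F j ∣)
    ≡⟨ sum-cong-≗ (λ j → cong (χ (P? j) *_) (∣p∣≡∑χ∈ (F j))) ⟩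
  ∑[ j < t ] (χ (P? j) * ∑[ x < m ] χ (x ∈? F j))
    ≡⟨ sum-cong-≗ (λ j → *-distribˡ-sum (χ (P? j)) (λ x → χ (x ∈? F j))) ⟩
  ∑[ j < t ] ∑[ x < m ] (χ (P? j) * χ (x ∈? F j))
    ≡⟨ ∑-comm (λ j x → χ (P? j) * χ (x ∈? F j)) ⟩
  ∑[ x < m ] ∑[ j < t ] (χ (P? j) * χ (x ∈? F j))
    ≡⟨ sum-cong-≗ (λ x → sum-cong-≗ (λ j → χ-× (P? j) (x ∈? F j))) ⟩
  ∑[ x < m ] ∑[ j < t ] χ (P? j ×-dec x ∈? F j)
    ≤⟨ sum-mono-≤ (λ x → atMostOne⇒sum-χ≤1 (λ j → P? j ×-dec x ∈? F j) (at-most-one x)) ⟩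
  ∑[ x < m ] 1
    ≡⟨ trans (sum-const m 1) (*-identityʳ m) ⟩
  m ∎
  where
  open ≤-Reasoning
  at-most-one : ∀ x j j' → P j × x ∈ F j → P j' × x ∈ F j' → j ≡ j'
  at-most-one x j j' (Pj , x∈Fj) (Pj' , x∈Fj') with j ≟ᶠ j'
  ... | yes j≡j' = j≡j'
  ... | no  j≢j' = ⊥-elim (disjoint j j' j≢j' Pj Pj' (x , x∈p∩q⁺ (x∈Fj , x∈Fj')))

_≟ˢ_ : ∀ {m} → DecidableEquality (Subset m)
_≟ˢ_ = ≡-dec _≟ᵇ_

sumSubsets : ∀ {m} → (Subset m → ℕ) → ℕ
sumSubsets {zero}  w = w []
sumSubsets {suc m} w = sumSubsets (w ∘ (inside ∷_)) + sumSubsets (w ∘ (outside ∷_))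

sumSubsets-mono-≤ : ∀ {m} {v w : Subset m → ℕ} → (∀ S → v S ≤ w S) → sumSubsets v ≤ sumSubsets w
sumSubsets-mono-≤ {zero}  v≤w = v≤w []
sumSubsets-mono-≤ {suc m} v≤w =
  +-mono-≤ (sumSubsets-mono-≤ (v≤w ∘ (inside ∷_))) (sumSubsets-mono-≤ (v≤w ∘ (outside ∷_)))

sumSubsets-zero : ∀ {m} {w : Subset m → ℕ} → (∀ S → w S ≡ 0) → sumSubsets w ≡ 0
sumSubsets-zero {zero}  w≡0 = w≡0 []
sumSubsets-zero {suc m} w≡0 =
  cong₂ _+_ (sumSubsets-zero (w≡0 ∘ (inside ∷_))) (sumSubsets-zero (w≡0 ∘ (outside ∷_)))

*-distribˡ-sumSubsets : ∀ {m} a (w : Subset m → ℕ) →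
                        a * sumSubsets w ≡ sumSubsets (λ S → a * w S)
*-distribˡ-sumSubsets {zero}  a w = refl
*-distribˡ-sumSubsets {suc m} a w =
  trans (*-distribˡ-+ a (sumSubsets (w ∘ (inside ∷_))) _)
        (cong₂ _+_ (*-distribˡ-sumSubsets a (w ∘ (inside ∷_))) (*-distribˡ-sumSubsets a (w ∘ (outside ∷_))))

sumSubsets-sum : ∀ {m t} (w : Fin t → Subset m → ℕ) →
                 sumSubsets (λ S → ∑[ j < t ] w j S) ≡ ∑[ j < t ] sumSubsets (w j)
sumSubsets-sum {zero}  w = refl
sumSubsets-sum {suc m} w =
  trans (cong₂ _+_ (sumSubsets-sum (λ j → w j ∘ (inside ∷_))) (sumSubsets-sum (λ j → w j ∘ (outside ∷_))))
        (sym (∑-distrib-+ (λ j → sumSubsets (w j ∘ (inside ∷_))) (λ j → sumSubsets (w j ∘ (outside ∷_)))))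

sumSubsets-δ : ∀ {m} (T : Subset m) (w : Subset m → ℕ) →
               sumSubsets (λ S → χ (T ≟ˢ S) * w S) ≡ w T
sumSubsets-δ []                    w = +-identityʳ (w [])
sumSubsets-δ {suc m} (inside ∷ T)  w =
  trans (cong₂ _+_ (sumSubsets-δ T (w ∘ (inside ∷_))) (sumSubsets-zero {m} (λ _ → refl))) (+-identityʳ _)
sumSubsets-δ {suc m} (outside ∷ T) w =
  cong₂ _+_ (sumSubsets-zero {m} (λ _ → refl)) (sumSubsets-δ T (w ∘ (outside ∷_)))

sumSubsets-pow∣∁∣ : ∀ m a → sumSubsets (λ (S : Subset m) → a ^ ∣ ∁ S ∣) ≡ suc a ^ m
sumSubsets-pow∣∁∣ zero    a = refl
sumSubsets-pow∣∁∣ (suc m) a = begin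
  X + sumSubsets (λ (S : Subset m) → a * a ^ ∣ ∁ S ∣)
    ≡⟨ cong (X +_) (*-distribˡ-sumSubsets {m} a (λ S → a ^ ∣ ∁ S ∣)) ⟨
  X + a * X
    ≡⟨ cong (λ Y → Y + a * Y) (sumSubsets-pow∣∁∣ m a) ⟩
  suc a ^ suc m ∎
  where
  open ≡-Reasoning
  X : ℕ
  X = sumSubsets (λ (S : Subset m) → a ^ ∣ ∁ S ∣)

injectiveOn⇒sum-χ*w≤sumSubsets :
  ∀ {m t p} {P : Pred (Fin t) p} (P? : Decidable P) (F : Fin t → Subset m) →
  (∀ j j' → P j → P j' → F j ≡ F j' → j ≡ j') → (w : Subset m → ℕ) →
  ∑[ j < t ] (χ (P? j) * w (F j)) ≤ sumSubsets w
injectiveOn⇒sum-χ*w≤sumSubsets {t = t} {P = P} P? F injective w = begin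
  ∑[ j < t ] (χ (P? j) * w (F j))
    ≡⟨ sum-cong-≗ (λ j → sym (sumSubsets-δ (F j) (λ S → χ (P? j) * w S))) ⟩
  ∑[ j < t ] sumSubsets (λ S → χ (F j ≟ˢ S) * (χ (P? j) * w S))
    ≡⟨ sumSubsets-sum (λ j S → χ (F j ≟ˢ S) * (χ (P? j) * w S)) ⟨
  sumSubsets (λ S → ∑[ j < t ] (χ (F j ≟ˢ S) * (χ (P? j) * w S)))
    ≤⟨ sumSubsets-mono-≤ multiplicity-≤ ⟩
  sumSubsets w ∎
  where
  open ≤-Reasoning
  multiplicity-≤ : ∀ S → ∑[ j < t ] (χ (F j ≟ˢ S) * (χ (P? j) * w S)) ≤ w S
  multiplicity-≤ S = begin
    ∑[ j < t ] (χ (F j ≟ˢ S) * (χ (P? j) * w S))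
      ≡⟨ sum-cong-≗ (λ j → sym (*-assoc (χ (F j ≟ˢ S)) (χ (P? j)) (w S))) ⟩
    ∑[ j < t ] (χ (F j ≟ˢ S) * χ (P? j) * w S)
      ≡⟨ sum-cong-≗ (λ j → cong (_* w S) (χ-× (F j ≟ˢ S) (P? j))) ⟩
    ∑[ j < t ] (χ (F j ≟ˢ S ×-dec P? j) * w S)
      ≡⟨ *-distribʳ-sum (w S) (λ j → χ (F j ≟ˢ S ×-dec P? j)) ⟨
    ∑[ j < t ] χ (F j ≟ˢ S ×-dec P? j) * w S
      ≤⟨ *-monoˡ-≤ (w S) (atMostOne⇒sum-χ≤1 (λ j → F j ≟ˢ S ×-dec P? j) (at-most-one S)) ⟩
    1 * w S
      ≡⟨ *-identityˡ (w S) ⟩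
    w S ∎
    where
    at-most-one : ∀ S j j' → F j ≡ S × P j → F j' ≡ S × P j' → j ≡ j'
    at-most-one S j j' (Fj≡S , Pj) (Fj'≡S , Pj') = injective j j' Pj Pj' (trans Fj≡S (sym Fj'≡S))

transpose-matchˡ : ∀ {t} (i j : Fin t) → Perm.transpose i j ⟨$⟩ʳ i ≡ j
transpose-matchˡ i j rewrite dec-true (i ≟ᶠ i) refl = refl

transpose-fix : ∀ {t} {i j l : Fin t} → l ≢ i → l ≢ j → Perm.transpose i j ⟨$⟩ʳ l ≡ l
transpose-fix {i = i} {j} {l} l≢i l≢j
  rewrite dec-false (l ≟ᶠ i) l≢i | dec-false (l ≟ᶠ j) l≢j = refl

transpose-invariant : ∀ {a t} {A : Set a} (f : Fin t → A) {i j : Fin t} → f i ≡ f j →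
                      ∀ l → f (Perm.transpose i j ⟨$⟩ʳ l) ≡ f l
transpose-invariant f {i} {j} fi≡fj l with l ≟ᶠ i
... | yes refl = sym fi≡fj
... | no _ with l ≟ᶠ j
...   | yes refl = fi≡fj
...   | no _     = refl

resolution-∘-permutation : ∀ {m t n} {F : Multiset m t} {c : Fin t → Fin n} (π : Permutation t t) →
                           (∀ j → F (π ⟨$⟩ʳ j) ≡ F j) →
                           IsResolution n F c → IsResolution n F (c ∘ (π ⟨$⟩ʳ_))
resolution-∘-permutation {F = F} {c} π Fπ≗F (surjective , classes) =
  surjective′ , λ i → disjoint′ i , cover′ i
  where
  c∘π∘π⁻¹ : ∀ j → c (π ⟨$⟩ʳ (π ⟨$⟩ˡ j)) ≡ c j
  c∘π∘π⁻¹ j = cong c (Perm.inverseʳ π)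
  F∘π⁻¹ : ∀ j → F (π ⟨$⟩ˡ j) ≡ F j
  F∘π⁻¹ j = trans (sym (Fπ≗F (π ⟨$⟩ˡ j))) (cong F (Perm.inverseʳ π))
  π-injective : ∀ {j j'} → π ⟨$⟩ʳ j ≡ π ⟨$⟩ʳ j' → j ≡ j'
  π-injective eq = trans (sym (Perm.inverseˡ π)) (trans (cong (π ⟨$⟩ˡ_) eq) (Perm.inverseˡ π))
  surjective′ : IsPartition _ (c ∘ (π ⟨$⟩ʳ_))
  surjective′ i = let (j , cj≡i) = surjective i in π ⟨$⟩ˡ j , trans (c∘π∘π⁻¹ j) cj≡i
  disjoint′ : ∀ i j j' → j ≢ j' → c (π ⟨$⟩ʳ j) ≡ i → c (π ⟨$⟩ʳ j') ≡ i → Empty (F j ∩ F j')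
  disjoint′ i j j' j≢j' = subst₂ (λ A B → _ → _ → Empty (A ∩ B)) (Fπ≗F j) (Fπ≗F j')
    (proj₁ (classes i) (π ⟨$⟩ʳ j) (π ⟨$⟩ʳ j') (j≢j' ∘ π-injective))
  cover′ : ∀ i x → ∃ λ j → c (π ⟨$⟩ʳ j) ≡ i × x ∈ F j
  cover′ i x = let (j , cj≡i , x∈Fj) = proj₂ (classes i) x in
    π ⟨$⟩ˡ j , trans (c∘π∘π⁻¹ j) cj≡i , subst (x ∈_) (sym (F∘π⁻¹ j)) x∈Fj

small? : ∀ {m t} (F : Multiset m t) k j → Dec (k * ∣ F j ∣ ≤ m)
small? {m} F k j = k * ∣ F j ∣ ≤? m

module _ {m t n} {F : Multiset m t} {c : Fin t → Fin n} (resolution : IsResolution n F c) where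

  classSize≤m : ∀ i → ∑[ j < t ] (χ (c j ≟ᶠ i) * ∣ F j ∣) ≤ m
  classSize≤m i = disjoint⇒sum-χ*∣∣≤n (λ j → c j ≟ᶠ i) F (proj₁ (proj₂ resolution i))

  #large≤n*a : ∀ a → ∑[ j < t ] χ (¬? (small? F (suc a) j)) ≤ n * a
  #large≤n*a a = begin
    ∑[ j < t ] χ (¬? (small? F (suc a) j))
      ≡⟨ sum-fibres c (χ ∘ ¬? ∘ small? F (suc a)) ⟩
    ∑[ i < n ] ∑[ j < t ] (χ (c j ≟ᶠ i) * χ (¬? (small? F (suc a) j)))
      ≤⟨ sum-mono-≤ (λ i → sum-χ*χ-large≤a (λ j → c j ≟ᶠ i) (∣_∣ ∘ F) a (classSize≤m i)) ⟩
    ∑[ i < n ] a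
      ≡⟨ sum-const n a ⟩
    n * a ∎
    where open ≤-Reasoning

  module _ (nonempty : AllNonempty F) where

    repeated⇒differentClasses : ∀ {j j'} → j ≢ j' → F j ≡ F j' → c j ≢ c j'
    repeated⇒differentClasses {j} {j'} j≢j' Fj≡Fj' cj≡cj' =
      proj₁ (proj₂ resolution (c j)) j j' j≢j' refl (sym cj≡cj')
        (x , x∈p∩q⁺ (x∈Fj , subst (x ∈_) Fj≡Fj' x∈Fj))
      where
      x : Fin m
      x = proj₁ (nonempty j)
      x∈Fj : x ∈ F j
      x∈Fj = proj₂ (nonempty j)

    module _ (unique : ∀ c' → IsResolution n F c' → SamePartition c c') where

      repeated⇒full : ∀ {j j'} → j ≢ j' → F j ≡ F j' → ∀ x → x ∈ F j
      repeated⇒full {j} {j'} j≢j' Fj≡Fj' x with x ∈? F j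
      ... | yes x∈Fj = x∈Fj
      ... | no  x∉Fj = ⊥-elim (repeated⇒differentClasses j≢j' Fj≡Fj' cj≡cj')
        where
        π : Permutation t t
        π = Perm.transpose j j'
        covering : ∃ λ l → c l ≡ c j × x ∈ F l
        covering = proj₂ (proj₂ resolution (c j)) x
        j'' : Fin t
        j'' = proj₁ covering
        cj≡cj'' : c j ≡ c j''
        cj≡cj'' = sym (proj₁ (proj₂ covering))
        j''≢j : j'' ≢ j
        j''≢j j''≡j = x∉Fj (subst (λ l → x ∈ F l) j''≡j (proj₂ (proj₂ covering)))
        j''≢j' : j'' ≢ j'
        j''≢j' j''≡j' = repeated⇒differentClasses j≢j' Fj≡Fj' (trans cj≡cj'' (cong c j''≡j'))
        same-partition : (c j ≡ c j'') ⇔ (c (π ⟨$⟩ʳ j) ≡ c (π ⟨$⟩ʳ j''))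
        same-partition = unique (c ∘ (π ⟨$⟩ʳ_))
          (resolution-∘-permutation π (transpose-invariant F Fj≡Fj') resolution) j j''
        cj≡cj' : c j ≡ c j'
        cj≡cj' = begin
          c j                ≡⟨ cj≡cj'' ⟩
          c j''              ≡⟨ cong c (transpose-fix j''≢j j''≢j') ⟨
          c (π ⟨$⟩ʳ j'')     ≡⟨ Equivalence.to same-partition cj≡cj'' ⟨
          c (π ⟨$⟩ʳ j)       ≡⟨ cong c (transpose-matchˡ j j') ⟩
          c j'               ∎
          where open ≡-Reasoning

      proper⇒unrepeated : ∀ {j j'} → ∣ F j ∣ < m → F j ≡ F j' → j ≡ j'
      proper⇒unrepeated {j} {j'} ∣Fj∣<m Fj≡Fj' with j ≟ᶠ j'
      ... | yes j≡j' = j≡j'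
      ... | no  j≢j' = contradiction (full⇒n≤∣p∣ (repeated⇒full j≢j' Fj≡Fj')) (<⇒≱ ∣Fj∣<m)

      #small*pow≤ : ∀ a .{{_ : NonZero a}} → 0 < m →
                    ∑[ j < t ] χ (small? F (suc a) j) * a ^ (m ∸ m / suc a) ≤ suc a ^ m
      #small*pow≤ a 0<m = begin
        ∑[ j < t ] χ (small? F k j) * r
          ≡⟨ *-distribʳ-sum r (χ ∘ small? F k) ⟩
        ∑[ j < t ] (χ (small? F k j) * r)
          ≤⟨ sum-mono-≤ (λ j → χ*-monoʳ-≤ (small? F k j) (r≤weight j)) ⟩
        ∑[ j < t ] (χ (small? F k j) * weight (F j))
          ≤⟨ injectiveOn⇒sum-χ*w≤sumSubsets (small? F k) F small-unrepeated weight ⟩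
        sumSubsets weight
          ≡⟨ sumSubsets-pow∣∁∣ m a ⟩
        k ^ m ∎
        where
        open ≤-Reasoning
        k r : ℕ
        k = suc a
        r = a ^ (m ∸ m / k)
        weight : Subset m → ℕ
        weight S = a ^ ∣ ∁ S ∣
        r≤weight : ∀ j → k * ∣ F j ∣ ≤ m → r ≤ weight (F j)
        r≤weight j small = subst (r ≤_) (cong (a ^_) (sym (∣∁p∣≡n∸∣p∣ (F j)))) (pow-∸-≤ a small)
        small⇒proper : ∀ {j} → k * ∣ F j ∣ ≤ m → ∣ F j ∣ < m
        small⇒proper small =
          ≤-<-trans (m*n≤o⇒n≤o/m k small) (m/n<m m k {{>-nonZero 0<m}} (s≤s (>-nonZero⁻¹ a)))
        small-unrepeated : ∀ j j' → k * ∣ F j ∣ ≤ m → k * ∣ F j' ∣ ≤ m → F j ≡ F j' → j ≡ j'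
        small-unrepeated j j' small _ = proper⇒unrepeated (small⇒proper small)

lemma26 : (n m k : ℕ) → 0 < n → 0 < m → k ≥ 2 → EntropyBound n m k →
    ∀ (t : ℕ) (F : Multiset m t) → AllNonempty F → UniquelyResolvable n F →
    t ≤ k * n
lemma26 n m 0 _ _ ()
lemma26 n m 1 _ _ (s≤s ())
lemma26 n m (suc a@(suc _)) _ 0<m _ entropy t F nonempty (c , resolution , unique) =
  ≮⇒≥ λ kn<t → ¬EntropyBound n m a (begin
    n * r          ≤⟨ *-monoˡ-≤ r (<⇒≤ (n<#small kn<t)) ⟩
    #small * r     ≤⟨ #small*pow≤ resolution nonempty unique a 0<m ⟩
    suc a ^ m      ∎) entropy
  where
  open ≤-Reasoning
  r #small : ℕ
  r = a ^ (m ∸ m / suc a)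
  #small = ∑[ j < t ] χ (small? F (suc a) j)
  n<#small : suc a * n < t → n < #small
  n<#small kn<t = +-cancelʳ-< (n * a) n #small (begin-strict
    n + n * a                                        ≡⟨ cong (n +_) (*-comm n a) ⟩
    suc a * n                                        <⟨ kn<t ⟩
    t                                                ≡⟨ sum-χ+sum-χ¬ (small? F (suc a)) ⟨
    #small + ∑[ j < t ] χ (¬? (small? F (suc a) j))  ≤⟨ +-monoʳ-≤ #small (#large≤n*a resolution a) ⟩
    #small + n * a                                   ∎)
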